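{- Let $n\in\mathbb{N}$ be even with $n\geq 142$, and let $G=C_n(\{1,3,n-3,n-1\})$. Then $\lambda_{(3,2,1)}(G)\leq 12$.
   Context: For $n\ge 3$ and $S\subseteq\{1,\dots,n-1\}$ closed under $x\mapsto n-x$, the circulant $C_n(S)$ is the graph with vertex set $\{u_1,\dots,u_n\}$ in which $u_iu_j$ is an edge iff $|i-j|\in S$. An $L(3,2,1)$-labeling of a graph $G$ is a function $f:V(G)\to\mathbb{N}\cup\{0\}$ such that $|f(x)-f(y)|>3-\operatorname{dist}_G(x,y)$ for all distinct $x,y\in V(G)$. $\lambda_{(3,2,1)}(G)$ is the minimum, over all $L(3,2,1)$-labelings of $G$, of the difference between the largest and smallest label used. -}

module Defs where

open import Data.Nat using (ℕ; zero; suc; _+_; _∸_; _≤_; _<_; ∣_-_∣)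
open import Data.Fin using (Fin; toℕ)
open import Data.Product using (_×_; ∃)
open import Data.Sum using (_⊎_)
open import Relation.Binary.PropositionalEquality using (_≡_)
open import Relation.Nullary using (¬_)

data Walk {V : Set} (Adj : V → V → Set) : V → V → ℕ → Set where
  nil  : ∀ {x} → Walk Adj x x 0
  cons : ∀ {x y z k} → Adj x y → Walk Adj y z k → Walk Adj x z (suc k)

-- dist_G(x,y) = d : shortest walk (hence shortest path) from x to y has length d.
-- If x and y are disconnected, no d satisfies this (distance = ∞).
IsDist : {V : Set} (Adj : V → V → Set) → V → V → ℕ → Set
IsDist Adj x y d = Walk Adj x y d × (∀ k → Walk Adj x y k → d ≤ k)

-- Circulant graph C_n(S) on vertices u_0..u_{n-1} (indices shifted by one,
-- which does not change |i - j|): u_i u_j edge iff |i - j| ∈ S.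
CirculantAdj : (n : ℕ) → (S : ℕ → Set) → Fin n → Fin n → Set
CirculantAdj n S i j = S ∣ toℕ i - toℕ j ∣

S13 : ℕ → ℕ → Set
S13 n d = d ≡ 1 ⊎ d ≡ 3 ⊎ d ≡ n ∸ 3 ⊎ d ≡ n ∸ 1

-- L(3,2,1)-labeling: |f x - f y| > 3 - dist(x,y) for all distinct x,y,
-- written over ℕ as 3 < dist(x,y) + |f x - f y| (equivalent to the integer inequality).
IsL321 : {V : Set} (Adj : V → V → Set) → (V → ℕ) → Set
IsL321 {V} Adj f = ∀ (x y : V) → ¬ (x ≡ y) → ∀ d → IsDist Adj x y d →
  3 < d + ∣ f x - f y ∣

λ321≤ : {V : Set} (Adj : V → V → Set) → ℕ → Set
λ321≤ {V} Adj m = ∃ λ (f : V → ℕ) → IsL321 Adj f × (∀ (x y : V) → f x ∸ f y ≤ m)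

-- A walk of length k ≤ 3 in C_n({1,3,n-3,n-1}) joins vertices whose cyclic offset is the absolute
-- value of a signed sum of k steps ±1, ±3, so a labeling works as soon as labels D < 10 apart on the
-- cycle differ by at least gap D. Label vertex u_i by s (9 + i) for a sequence s whose first 9 terms
-- repeat the last 9 labels of the cycle: then every such pair, wrapping around or not, is a pair of
-- positions of s at distance D, and it suffices that s be separated. We take s to be an explicit
-- prefix followed by the 12-periodic pattern i ↦ 5i mod 12, so separation is a finite check. Writing
-- an even n ≥ 142 as 142 + 2c + 12a with c < 6, one prefix for each c covers all such n.

module Submission where

open import Defs
open import Data.Nat using (ℕ; _≤_)
open import Data.Nat.Divisibility using (_∣_)

open import Data.Fin using (Fin; zero; suc; toℕ)
open import Data.Fin.Properties as Fin using (toℕ<n; toℕ-injective)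
open import Data.List using (List; []; _∷_; length; applyUpTo; upTo; concatMap)
open import Data.List.Relation.Unary.All using (All; []; _∷_; all?; lookupAny)
open import Data.List.Relation.Unary.All.Properties using (applyUpTo⁻; applyUpTo⁺₂)
open import Data.List.Relation.Unary.Any as Any using (Any; here; there)
open import Data.List.Relation.Unary.Any.Properties using (concatMap⁺)
open import Data.Nat
  using (zero; suc; _+_; _*_; _∸_; _<_; _%_; _/_; ∣_-_∣; NonZero; z≤n; s≤s; _≟_; _<?_; _≤?_)
open import Data.Nat.DivMod
  using ([m+kn]%n≡m%n; [m+n]%n≡m%n; m<n⇒m%n≡m; m%n<n; m≡m%n+[m/n]*n; result; _divMod_)
open import Data.Nat.Divisibility using (divides)
open import Data.Nat.Properties
open import Algebra.Properties.CommutativeSemigroup +-commutativeSemigroup using (xy∙z≈xz∙y)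
open import Data.Nat.Solver using (module +-*-Solver)
open import Data.Product using (_×_; _,_; ∃₂)
open import Data.Sum using (_⊎_; inj₁; inj₂; [_,_]; map; swap)
open import Function using (id; _∘_)
open import Relation.Binary.PropositionalEquality
  using (_≡_; refl; sym; trans; cong; subst; subst₂; module ≡-Reasoning)
open import Relation.Nullary using (Dec; yes; no; contradiction)
open import Relation.Nullary.Decidable using (_×-dec_; _⊎-dec_; from-yes)

open +-*-Solver using (solve; _:=_; _:+_; _:*_; con)
open ≡-Reasoning

-- For D ≥ 1, gap D = 4 ∸ (least k with D ∈ signedSums (1 ∷ 3 ∷ []) k): the label difference an
-- L(3,2,1)-labeling of C_n({1,3,n-3,n-1}) needs between vertices D apart on the cycle.
gap : ℕ → ℕ
gap 1 = 3
gap 2 = 2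
gap 3 = 3
gap 4 = 2
gap 5 = 1
gap 6 = 2
gap 7 = 1
gap 9 = 1
gap _ = 0

infix 4 _≡_[mod_]

_≡_[mod_] : ℕ → ℕ → ℕ → Set
a ≡ b [mod n ] = ∃₂ λ k l → a + k * n ≡ b + l * n

≡⇒≡[mod] : ∀ {a b} n → a ≡ b → a ≡ b [mod n ]
≡⇒≡[mod] n refl = 0 , 0 , refl

m+n≡m[mod] : ∀ m n → m + n ≡ m [mod n ]
m+n≡m[mod] m n = 0 , 1 , +-assoc m n 0

≡[mod]-sym : ∀ {a b n} → a ≡ b [mod n ] → b ≡ a [mod n ]
≡[mod]-sym (k , l , eq) = l , k , sym eq

≡[mod]-trans : ∀ {a b c n} → a ≡ b [mod n ] → b ≡ c [mod n ] → a ≡ c [mod n ]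
≡[mod]-trans {a} {b} {c} {n} (k , l , p) (k′ , l′ , q) = k + k′ , l′ + l , (begin
  a + (k + k′) * n      ≡⟨ split a k k′ ⟩
  a + k * n + k′ * n    ≡⟨ cong (_+ k′ * n) p ⟩
  b + l * n + k′ * n    ≡⟨ xy∙z≈xz∙y b (l * n) (k′ * n) ⟩
  b + k′ * n + l * n    ≡⟨ cong (_+ l * n) q ⟩
  c + l′ * n + l * n    ≡⟨ split c l′ l ⟨
  c + (l′ + l) * n      ∎)
  where
  split : ∀ x i j → x + (i + j) * n ≡ x + i * n + j * n
  split x i j = solve 4 (λ x i j n → x :+ (i :+ j) :* n := x :+ i :* n :+ j :* n) refl x i j n

≡[mod]-+ʳ : ∀ {a b n} c → a ≡ b [mod n ] → a + c ≡ b + c [mod n ]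
≡[mod]-+ʳ {a} {b} {n} c (k , l , eq) = k , l , (begin
  a + c + k * n  ≡⟨ xy∙z≈xz∙y a c (k * n) ⟩
  a + k * n + c  ≡⟨ cong (_+ c) eq ⟩
  b + l * n + c  ≡⟨ xy∙z≈xz∙y b (l * n) c ⟩
  b + c + l * n  ∎)

≡[mod]-cancelʳ : ∀ {a b n} c → a + c ≡ b + c [mod n ] → a ≡ b [mod n ]
≡[mod]-cancelʳ {a} {b} {n} c (k , l , eq) = k , l , +-cancelʳ-≡ c _ _ (begin
  a + k * n + c  ≡⟨ xy∙z≈xz∙y a (k * n) c ⟩
  a + c + k * n  ≡⟨ eq ⟩
  b + c + l * n  ≡⟨ xy∙z≈xz∙y b c (l * n) ⟩
  b + l * n + c  ∎)

≡[mod]-∸ : ∀ {u v a b n} → b ≤ a → u + a ≡ v + b [mod n ] → u + (a ∸ b) ≡ v [mod n ]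
≡[mod]-∸ {u} {v} {a} {b} {n} b≤a eq = ≡[mod]-cancelʳ b
  (subst (_≡ v + b [mod n ]) (sym (trans (+-assoc u (a ∸ b) b) (cong (u +_) (m∸n+n≡m b≤a)))) eq)

≡[mod]⇒%≡ : ∀ {a b n} .{{_ : NonZero n}} → a ≡ b [mod n ] → a % n ≡ b % n
≡[mod]⇒%≡ {a} {b} {n} (k , l , eq) = begin
  a % n          ≡⟨ [m+kn]%n≡m%n a k n ⟨
  (a + k * n) % n ≡⟨ cong (_% n) eq ⟩
  (b + l * n) % n ≡⟨ [m+kn]%n≡m%n b l n ⟩
  b % n          ∎

≡[mod]-reduce : ∀ {a b n} .{{_ : NonZero n}} → a ≡ b [mod n ] → b < n → b ≡ a % n
≡[mod]-reduce eq b<n = trans (sym (m<n⇒m%n≡m b<n)) (sym (≡[mod]⇒%≡ eq))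

infixr 5 _++ˢ_

_++ˢ_ : List ℕ → (ℕ → ℕ) → ℕ → ℕ
([] ++ˢ s) i = s i
((x ∷ xs) ++ˢ s) zero = x
((x ∷ xs) ++ˢ s) (suc i) = (xs ++ˢ s) i

++ˢ-shift : ∀ xs s i → (xs ++ˢ s) (length xs + i) ≡ s i
++ˢ-shift [] s i = refl
++ˢ-shift (x ∷ xs) s i = ++ˢ-shift xs s i

applyUpTo-++ˢ : ∀ f m s {i} → i < m → (applyUpTo f m ++ˢ s) i ≡ f i
applyUpTo-++ˢ f (suc m) s {zero} _ = refl
applyUpTo-++ˢ f (suc m) s {suc i} (s≤s i<m) = applyUpTo-++ˢ (f ∘ suc) m s i<m

++ˢ-≤ : ∀ {b} xs s → All (_≤ b) xs → (∀ i → s i ≤ b) → ∀ i → (xs ++ˢ s) i ≤ b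
++ˢ-≤ [] s _ s≤b i = s≤b i
++ˢ-≤ (x ∷ xs) s (x≤b ∷ _) _ zero = x≤b
++ˢ-≤ (x ∷ xs) s (_ ∷ xs≤b) s≤b (suc i) = ++ˢ-≤ xs s xs≤b s≤b i

periodic-shift : ∀ {P} {s : ℕ → ℕ} → (∀ i → s (P + i) ≡ s i) → ∀ q i → s (q * P + i) ≡ s i
periodic-shift per zero i = refl
periodic-shift {P} {s} per (suc q) i = begin
  s (P + q * P + i)   ≡⟨ cong s (+-assoc P (q * P) i) ⟩
  s (P + (q * P + i)) ≡⟨ per (q * P + i) ⟩
  s (q * P + i)       ≡⟨ periodic-shift per q i ⟩
  s i                 ∎

GapsAt : (ℕ → ℕ) → ℕ → Set
GapsAt s i = ∀ D → D < 10 → gap D ≤ ∣ s i - s (i + D) ∣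

Separated : (ℕ → ℕ) → Set
Separated s = ∀ i → GapsAt s i

GapsBelow : ℕ → (ℕ → ℕ) → Set
GapsBelow m s = All (λ i → All (λ D → gap D ≤ ∣ s i - s (i + D) ∣) (upTo 10)) (upTo m)

gapsBelow? : ∀ m s → Dec (GapsBelow m s)
gapsBelow? m s = all? (λ i → all? (λ D → gap D ≤? ∣ s i - s (i + D) ∣) (upTo 10)) (upTo m)

gapsBelow⇒gapsAt : ∀ {m} s → GapsBelow m s → ∀ {i} → i < m → GapsAt s i
gapsBelow⇒gapsAt {m} s g i<m D = applyUpTo⁻ id 10 (applyUpTo⁻ id m g i<m)

gapsAt-transport : ∀ s t {i j} → (∀ D → s (i + D) ≡ t (j + D)) → GapsAt s i → GapsAt t j
gapsAt-transport s t {i} {j} eq g D D<10 =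
  subst₂ (λ a b → gap D ≤ ∣ a - b ∣) here-eq (eq D) (g D D<10)
  where
  here-eq : s i ≡ t j
  here-eq = begin
    s i       ≡⟨ cong s (+-identityʳ i) ⟨
    s (i + 0) ≡⟨ eq 0 ⟩
    t (j + 0) ≡⟨ cong t (+-identityʳ j) ⟩
    t j       ∎

separated-periodic : ∀ {P} {s : ℕ → ℕ} .{{_ : NonZero P}} →
                     (∀ i → s (P + i) ≡ s i) → GapsBelow P s → Separated s
separated-periodic {P} {s} per g i =
  subst (GapsAt s) i≡ (gapsAt-transport s s shift (gapsBelow⇒gapsAt s g (m%n<n i P)))
  where
  i≡ : i / P * P + i % P ≡ i
  i≡ = trans (+-comm (i / P * P) (i % P)) (sym (m≡m%n+[m/n]*n i P))
  shift : ∀ D → s (i % P + D) ≡ s (i / P * P + i % P + D)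
  shift D = sym (trans (cong s (+-assoc (i / P * P) (i % P) D)) (periodic-shift per (i / P) (i % P + D)))

separated-++ˢ : ∀ xs {s} → Separated s → GapsBelow (length xs) (xs ++ˢ s) → Separated (xs ++ˢ s)
separated-++ˢ xs {s} sep g i with i <? length xs
... | yes i<len = gapsBelow⇒gapsAt (xs ++ˢ s) g i<len
... | no i≮len =
  subst (GapsAt (xs ++ˢ s)) (m+[n∸m]≡n (≮⇒≥ i≮len)) (gapsAt-transport s (xs ++ˢ s) shift (sep j))
  where
  j : ℕ
  j = i ∸ length xs
  shift : ∀ D → s (j + D) ≡ (xs ++ˢ s) (length xs + j + D)
  shift D = sym (trans (cong (xs ++ˢ s) (+-assoc (length xs) j D)) (++ˢ-shift xs s (j + D)))

wave : ℕ → ℕ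
wave i = 5 * i % 12

wave-periodic : ∀ i → wave (12 + i) ≡ wave i
wave-periodic i = begin
  5 * (12 + i) % 12      ≡⟨ cong (_% 12) (trans (*-distribˡ-+ 5 12 i) (+-comm 60 (5 * i))) ⟩
  (5 * i + 5 * 12) % 12  ≡⟨ [m+kn]%n≡m%n (5 * i) 5 12 ⟩
  5 * i % 12             ∎

wave-≤ : ∀ i → wave i ≤ 12
wave-≤ i = <⇒≤ (m%n<n (5 * i) 12)

wave-separated : Separated wave
wave-separated = separated-periodic wave-periodic (from-yes (gapsBelow? 12 wave))

signedSums : List ℕ → ℕ → List ℕ
signedSums gs zero = 0 ∷ []
signedSums gs (suc k) = concatMap (λ D → concatMap (λ g → g + D ∷ ∣ g - D ∣ ∷ []) gs) (signedSums gs k)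

signedSums-gap : ∀ {k} → k < 4 → All (λ D → D ≡ 0 ⊎ D < 10 × 3 < k + gap D) (signedSums (1 ∷ 3 ∷ []) k)
signedSums-gap = applyUpTo⁻ id 4 (from-yes (all? (λ k → all? (λ D →
  D ≟ 0 ⊎-dec D <? 10 ×-dec 3 <? k + gap D) (signedSums (1 ∷ 3 ∷ []) k)) (upTo 4)))

module Cycle (n : ℕ) .{{_ : NonZero n}} where

  Offset : ℕ → Fin n → Fin n → Set
  Offset D x y = toℕ x + D ≡ toℕ y [mod n ]

  Apart : ℕ → Fin n → Fin n → Set
  Apart D x y = Offset D x y ⊎ Offset D y x

  ≡[mod]⇒≡ : ∀ {x y : Fin n} → toℕ x ≡ toℕ y [mod n ] → x ≡ y
  ≡[mod]⇒≡ {x} {y} eq = toℕ-injective (begin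
    toℕ x          ≡⟨ m<n⇒m%n≡m (toℕ<n x) ⟨
    toℕ x % n      ≡⟨ ≡[mod]⇒%≡ eq ⟩
    toℕ y % n      ≡⟨ m<n⇒m%n≡m (toℕ<n y) ⟩
    toℕ y          ∎)

  apart-refl : ∀ x → Apart 0 x x
  apart-refl x = inj₁ (≡⇒≡[mod] n (+-identityʳ (toℕ x)))

  offset-0⇒≡ : ∀ {x y} → Offset 0 x y → x ≡ y
  offset-0⇒≡ {x} {y} o = ≡[mod]⇒≡ (subst (_≡ toℕ y [mod n ]) (+-identityʳ (toℕ x)) o)

  apart-0⇒≡ : ∀ {x y} → Apart 0 x y → x ≡ y
  apart-0⇒≡ (inj₁ o) = offset-0⇒≡ o
  apart-0⇒≡ (inj₂ o) = sym (offset-0⇒≡ o)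

  apart-of-≡[mod] : ∀ {x y} a b → toℕ x + a ≡ toℕ y + b [mod n ] → Apart ∣ a - b ∣ x y
  apart-of-≡[mod] {x} {y} a b eq with ≤-total b a
  ... | inj₁ b≤a = subst (λ d → Apart d x y) (sym (m≤n⇒∣n-m∣≡n∸m b≤a)) (inj₁ (≡[mod]-∸ b≤a eq))
  ... | inj₂ a≤b =
    subst (λ d → Apart d x y) (sym (m≤n⇒∣m-n∣≡n∸m a≤b)) (inj₂ (≡[mod]-∸ a≤b (≡[mod]-sym eq)))

  apart-∣-∣ : ∀ x y → Apart ∣ toℕ x - toℕ y ∣ x y
  apart-∣-∣ x y = subst (λ d → Apart d x y) (∣-∣-comm (toℕ y) (toℕ x))
    (apart-of-≡[mod] (toℕ y) (toℕ x) (≡⇒≡[mod] n (+-comm (toℕ x) (toℕ y))))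

  offset-complement : ∀ {g x y} → g ≤ n → Offset (n ∸ g) x y → Offset g y x
  offset-complement {g} {x} g≤n o = ≡[mod]-trans (≡[mod]-sym (≡[mod]-+ʳ g o))
    (subst (_≡ toℕ x [mod n ]) (sym (trans (+-assoc (toℕ x) (n ∸ g) g) (cong (toℕ x +_) (m∸n+n≡m g≤n))))
      (m+n≡m[mod] (toℕ x) n))

  apart-complement : ∀ {g x y} → g ≤ n → Apart (n ∸ g) x y → Apart g x y
  apart-complement g≤n = swap ∘ map (offset-complement g≤n) (offset-complement g≤n)

  offset-trans : ∀ {A B x y z} → Offset A x y → Offset B y z → Offset (A + B) x z
  offset-trans {A} {B} {x} {y} {z} p q =
    subst (_≡ toℕ z [mod n ]) (+-assoc (toℕ x) A B) (≡[mod]-trans (≡[mod]-+ʳ B p) q)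

  apart-trans : ∀ {A B x y z} → Apart A x y → Apart B y z → Apart (A + B) x z ⊎ Apart ∣ A - B ∣ x z
  apart-trans {A} {B} {x} {y} {z} (inj₁ p) (inj₁ q) = inj₁ (inj₁ (offset-trans {A} {B} {x} {y} {z} p q))
  apart-trans {A} {B} {x} {y} {z} (inj₂ p) (inj₂ q) =
    inj₁ (inj₂ (subst (λ d → Offset d z x) (+-comm B A) (offset-trans {B} {A} {z} {y} {x} q p)))
  apart-trans {A} {B} (inj₁ p) (inj₂ q) = inj₂ (apart-of-≡[mod] A B (≡[mod]-trans p (≡[mod]-sym q)))
  apart-trans {A} {B} {x} {y} {z} (inj₂ p) (inj₁ q) =
    inj₂ (subst (λ d → Apart d x z) (∣-∣-comm B A) (apart-of-≡[mod] B A x+B≡z+A))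
    where
    x+B≡z+A : toℕ x + B ≡ toℕ z + A [mod n ]
    x+B≡z+A = ≡[mod]-trans (≡[mod]-sym (≡[mod]-+ʳ B p))
      (subst (_≡ toℕ z + A [mod n ]) (xy∙z≈xz∙y (toℕ y) B A) (≡[mod]-+ʳ A q))

  offset-unwrap : ∀ {D x y} → D ≤ n → Offset D x y → toℕ x + D ≡ toℕ y ⊎ toℕ x + D ≡ toℕ y + n
  offset-unwrap {D} {x} {y} D≤n o with toℕ x + D <? n
  ... | yes x+D<n = inj₁ (trans (sym (m<n⇒m%n≡m x+D<n)) (sym (≡[mod]-reduce o (toℕ<n y))))
  ... | no x+D≮n = inj₂ (begin
    toℕ x + D          ≡⟨ m∸n+n≡m n≤x+D ⟨
    toℕ x + D ∸ n + n  ≡⟨ cong (_+ n) (sym y≡w) ⟩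
    toℕ y + n          ∎)
    where
    n≤x+D : n ≤ toℕ x + D
    n≤x+D = ≮⇒≥ x+D≮n
    w : ℕ
    w = toℕ x + D ∸ n
    w<n : w < n
    w<n = +-cancelʳ-< n w n (subst (_< n + n) (sym (m∸n+n≡m n≤x+D)) (+-mono-<-≤ (toℕ<n x) D≤n))
    y≡w : toℕ y ≡ w
    y≡w = begin
      toℕ y            ≡⟨ ≡[mod]-reduce o (toℕ<n y) ⟩
      (toℕ x + D) % n  ≡⟨ cong (_% n) (m∸n+n≡m n≤x+D) ⟨
      (w + n) % n      ≡⟨ [m+n]%n≡m%n w n ⟩
      w % n            ≡⟨ m<n⇒m%n≡m w<n ⟩
      w                ∎

  adjacent⇒apart : 3 ≤ n → ∀ {x y} → CirculantAdj n (S13 n) x y → Any (λ g → Apart g x y) (1 ∷ 3 ∷ [])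
  adjacent⇒apart _ {x} {y} (inj₁ e) = here (subst (λ d → Apart d x y) e (apart-∣-∣ x y))
  adjacent⇒apart _ {x} {y} (inj₂ (inj₁ e)) = there (here (subst (λ d → Apart d x y) e (apart-∣-∣ x y)))
  adjacent⇒apart 3≤n {x} {y} (inj₂ (inj₂ (inj₁ e))) =
    there (here (apart-complement 3≤n (subst (λ d → Apart d x y) e (apart-∣-∣ x y))))
  adjacent⇒apart 3≤n {x} {y} (inj₂ (inj₂ (inj₂ e))) =
    here (apart-complement (≤-trans (s≤s z≤n) 3≤n) (subst (λ d → Apart d x y) e (apart-∣-∣ x y)))

  walk⇒apart : ∀ {Adj : Fin n → Fin n → Set} gs → (∀ {x y} → Adj x y → Any (λ g → Apart g x y) gs) →
               ∀ {x y k} → Walk Adj x y k → Any (λ D → Apart D x y) (signedSums gs k)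
  walk⇒apart gs adj {x} nil = here (apart-refl x)
  walk⇒apart gs adj (cons a w) =
    concatMap⁺ _ (Any.map (λ yz → concatMap⁺ _ (Any.map (λ xy → pair (apart-trans xy yz)) (adj a)))
                          (walk⇒apart gs adj w))
    where
    pair : ∀ {P : ℕ → Set} {a b} → P a ⊎ P b → Any P (a ∷ b ∷ [])
    pair = [ here , there ∘ here ]

  offset-gap : ∀ s p → Separated s → (∀ i → i < p → s (i + n) ≡ s i) →
               ∀ {D x y} → D < 10 → D ≤ p → D ≤ n → Offset D x y →
               gap D ≤ ∣ s (p + toℕ x) - s (p + toℕ y) ∣
  offset-gap s p sep wrap {D} {x} {y} D<10 D≤p D≤n o with offset-unwrap D≤n o
  ... | inj₁ x+D≡y = subst (λ j → gap D ≤ ∣ s (p + toℕ x) - s j ∣)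
          (trans (+-assoc p (toℕ x) D) (cong (p +_) x+D≡y)) (sep (p + toℕ x) D D<10)
  ... | inj₂ x+D≡y+n = subst₂ (λ a b → gap D ≤ ∣ a - b ∣)
          (trans (sym (wrap j j<p)) (cong s j+n≡p+x)) (cong s j+D≡p+y) (sep j D D<10)
    where
    w : ℕ
    w = p ∸ D
    w+D≡p : w + D ≡ p
    w+D≡p = m∸n+n≡m D≤p
    j : ℕ
    j = w + toℕ y
    j+D≡p+y : j + D ≡ p + toℕ y
    j+D≡p+y = trans (xy∙z≈xz∙y w (toℕ y) D) (cong (_+ toℕ y) w+D≡p)
    j+n≡p+x : j + n ≡ p + toℕ x
    j+n≡p+x = begin
      w + toℕ y + n    ≡⟨ +-assoc w (toℕ y) n ⟩
      w + (toℕ y + n)  ≡⟨ cong (w +_) (trans (sym x+D≡y+n) (+-comm (toℕ x) D)) ⟩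
      w + (D + toℕ x)  ≡⟨ +-assoc w D (toℕ x) ⟨
      w + D + toℕ x    ≡⟨ cong (_+ toℕ x) w+D≡p ⟩
      p + toℕ x        ∎
    y<D : toℕ y < D
    y<D = +-cancelʳ-< n (toℕ y) D
      (subst (_< D + n) x+D≡y+n (subst (toℕ x + D <_) (+-comm n D) (+-monoˡ-< D (toℕ<n x))))
    j<p : j < p
    j<p = subst (j <_) w+D≡p (+-monoʳ-< w y<D)

  λ321≤-of-separated : ∀ {m} s p → 9 ≤ p → 9 ≤ n → Separated s → (∀ i → i < p → s (i + n) ≡ s i) →
                       (∀ i → s i ≤ m) → λ321≤ (CirculantAdj n (S13 n)) m
  λ321≤-of-separated {m} s p 9≤p 9≤n sep wrap s≤m = f , labeling , span
    where
    f : Fin n → ℕ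
    f x = s (p + toℕ x)

    3≤n : 3 ≤ n
    3≤n = ≤-trans (s≤s (s≤s (s≤s z≤n))) 9≤n

    apart-gap : ∀ {D x y} → D < 10 → Apart D x y → gap D ≤ ∣ f x - f y ∣
    apart-gap D<10 (inj₁ o) =
      offset-gap s p sep wrap D<10 (≤-trans (≤-pred D<10) 9≤p) (≤-trans (≤-pred D<10) 9≤n) o
    apart-gap {D} {x} {y} D<10 (inj₂ o) =
      subst (gap D ≤_) (∣-∣-comm (f y) (f x)) (apart-gap {D} {y} {x} D<10 (inj₁ o))

    labeling : IsL321 (CirculantAdj n (S13 n)) f
    labeling x y x≢y d (walk , _) with d <? 4
    ... | no d≮4 = ≤-trans (≮⇒≥ d≮4) (m≤m+n d _)
    ... | yes d<4 with lookupAny (signedSums-gap d<4) (walk⇒apart (1 ∷ 3 ∷ []) (adjacent⇒apart 3≤n) walk)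
    ...   | inj₁ D≡0 , apart = contradiction (apart-0⇒≡ (subst (λ D → Apart D x y) D≡0 apart)) x≢y
    ...   | inj₂ (D<10 , 3<d+gap) , apart = <-≤-trans 3<d+gap (+-monoʳ-≤ d (apart-gap D<10 apart))

    span : ∀ x y → f x ∸ f y ≤ m
    span x y = ≤-trans (m∸n≤m (f x) (f y)) (s≤m _)

-- Positions 9, …, n + 8 of labelSeq xs label the cycle of length n = 9 + length xs + 12q, and
-- positions 0, …, 8 repeat its last 9 labels.
labelSeq : List ℕ → ℕ → ℕ
labelSeq xs = applyUpTo wave 9 ++ˢ xs ++ˢ wave

Admissible : List ℕ → Set
Admissible xs = GapsBelow (length xs) (xs ++ˢ wave) × GapsBelow 9 (labelSeq xs) × All (_≤ 12) xs

admissible? : ∀ xs → Dec (Admissible xs)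
admissible? xs =
  gapsBelow? (length xs) (xs ++ˢ wave) ×-dec gapsBelow? 9 (labelSeq xs) ×-dec all? (_≤? 12) xs

labelSeq-separated : ∀ {xs} → Admissible xs → Separated (labelSeq xs)
labelSeq-separated {xs} (g , g₉ , _) =
  separated-++ˢ (applyUpTo wave 9) (separated-++ˢ xs wave-separated g) g₉

labelSeq-≤ : ∀ {xs} → Admissible xs → ∀ i → labelSeq xs i ≤ 12
labelSeq-≤ {xs} (_ , _ , xs≤) =
  ++ˢ-≤ (applyUpTo wave 9) _ (applyUpTo⁺₂ wave 9 wave-≤) (++ˢ-≤ xs wave xs≤ wave-≤)

labelSeq-wrap : ∀ xs q i → i < 9 → labelSeq xs (i + (9 + length xs + q * 12)) ≡ labelSeq xs i
labelSeq-wrap xs q i i<9 = begin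
  labelSeq xs (i + (9 + length xs + q * 12))    ≡⟨ cong (labelSeq xs) (rearrange i (length xs) (q * 12)) ⟩
  labelSeq xs (9 + (length xs + (q * 12 + i)))  ≡⟨ ++ˢ-shift xs wave (q * 12 + i) ⟩
  wave (q * 12 + i)                             ≡⟨ periodic-shift wave-periodic q i ⟩
  wave i                                        ≡⟨ applyUpTo-++ˢ wave 9 (xs ++ˢ wave) i<9 ⟨
  labelSeq xs i                                 ∎
  where
  rearrange : ∀ i l m → i + (9 + l + m) ≡ 9 + (l + (m + i))
  rearrange = solve 3 (λ i l m → i :+ (con 9 :+ l :+ m) := con 9 :+ (l :+ (m :+ i))) refl

circulant-λ321≤12 : ∀ xs → Admissible xs → ∀ q →
                    let n = 9 + length xs + q * 12 in λ321≤ (CirculantAdj n (S13 n)) 12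
circulant-λ321≤12 xs adm q = Cycle.λ321≤-of-separated (9 + length xs + q * 12)
  (labelSeq xs) 9 ≤-refl (≤-trans (m≤m+n 9 (length xs)) (m≤m+n _ (q * 12)))
  (labelSeq-separated adm) (labelSeq-wrap xs q) (labelSeq-≤ adm)

prefix : Fin 6 → List ℕ
prefix zero = 9 ∷ 2 ∷ 7 ∷ 12 ∷ 5 ∷ 10 ∷ 3 ∷ 8 ∷ 0 ∷ 6 ∷ 11 ∷ 4 ∷ 9 ∷ 1 ∷ 7 ∷ 12 ∷ 5 ∷ 10 ∷ 2 ∷
  8 ∷ 0 ∷ 6 ∷ 11 ∷ 3 ∷ 9 ∷ 1 ∷ 7 ∷ 12 ∷ 4 ∷ 10 ∷ 2 ∷ 8 ∷ 0 ∷ 5 ∷ 11 ∷ 3 ∷ 9 ∷ 1 ∷ 6 ∷ 12 ∷ 4 ∷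
  10 ∷ 2 ∷ 7 ∷ 0 ∷ 5 ∷ 11 ∷ 3 ∷ 8 ∷ 1 ∷ 6 ∷ 12 ∷ 4 ∷ 9 ∷ 2 ∷ 7 ∷ 0 ∷ 5 ∷ 10 ∷ 3 ∷ 8 ∷ 1 ∷ 6 ∷
  11 ∷ 4 ∷ 9 ∷ 2 ∷ 7 ∷ 12 ∷ 5 ∷ 10 ∷ 3 ∷ 8 ∷ 0 ∷ 6 ∷ 11 ∷ 4 ∷ 9 ∷ 1 ∷ 7 ∷ 12 ∷ 5 ∷ 10 ∷ 2 ∷ 8 ∷
  0 ∷ 6 ∷ 11 ∷ 3 ∷ 9 ∷ 1 ∷ 7 ∷ 12 ∷ 4 ∷ 10 ∷ 2 ∷ 8 ∷ 0 ∷ 5 ∷ 11 ∷ 3 ∷ 9 ∷ 1 ∷ 6 ∷ 12 ∷ 4 ∷ 10 ∷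
  2 ∷ 7 ∷ 0 ∷ 5 ∷ 11 ∷ 3 ∷ 8 ∷ 1 ∷ 6 ∷ 12 ∷ 4 ∷ 9 ∷ 2 ∷ 7 ∷ []
prefix (suc zero) = 9 ∷ 2 ∷ 7 ∷ []
prefix (suc (suc zero)) = 9 ∷ 2 ∷ 7 ∷ 12 ∷ 5 ∷ 0 ∷ 3 ∷ 8 ∷ 11 ∷ 6 ∷ 1 ∷ 4 ∷ 9 ∷ 12 ∷ 7 ∷ 2 ∷ 5 ∷
  0 ∷ 11 ∷ 8 ∷ 3 ∷ 6 ∷ 1 ∷ 12 ∷ 9 ∷ 4 ∷ 7 ∷ 2 ∷ 11 ∷ 0 ∷ 5 ∷ 8 ∷ 3 ∷ 12 ∷ 1 ∷ 6 ∷ 9 ∷ 4 ∷ 11 ∷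
  2 ∷ 7 ∷ []
prefix (suc (suc (suc zero))) = 9 ∷ 0 ∷ 7 ∷ 12 ∷ 5 ∷ 10 ∷ 1 ∷ 8 ∷ 3 ∷ 6 ∷ 11 ∷ 0 ∷ 9 ∷ 4 ∷ 7 ∷
  12 ∷ 1 ∷ 10 ∷ 5 ∷ 8 ∷ 3 ∷ 0 ∷ 11 ∷ 6 ∷ 9 ∷ 4 ∷ 1 ∷ 12 ∷ 7 ∷ 10 ∷ 5 ∷ 0 ∷ 3 ∷ 8 ∷ 11 ∷ 6 ∷ 1 ∷
  4 ∷ 9 ∷ 12 ∷ 7 ∷ 2 ∷ 5 ∷ 0 ∷ 11 ∷ 8 ∷ 3 ∷ 6 ∷ 1 ∷ 12 ∷ 9 ∷ 4 ∷ 7 ∷ 2 ∷ 11 ∷ 0 ∷ 5 ∷ 8 ∷ 3 ∷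
  12 ∷ 1 ∷ 6 ∷ 9 ∷ 4 ∷ 11 ∷ 2 ∷ 7 ∷ []
prefix (suc (suc (suc (suc zero)))) = 9 ∷ 2 ∷ 7 ∷ 12 ∷ 5 ∷ 0 ∷ 3 ∷ 8 ∷ 11 ∷ 6 ∷ 1 ∷ 4 ∷ 9 ∷ 12 ∷
  7 ∷ 2 ∷ 5 ∷ 0 ∷ 11 ∷ 8 ∷ 3 ∷ 6 ∷ 1 ∷ 12 ∷ 9 ∷ 4 ∷ 7 ∷ 2 ∷ 11 ∷ 0 ∷ 5 ∷ 8 ∷ 3 ∷ 12 ∷ 1 ∷ 6 ∷
  9 ∷ 4 ∷ 11 ∷ 2 ∷ 7 ∷ 0 ∷ 5 ∷ 12 ∷ 3 ∷ 8 ∷ 1 ∷ 6 ∷ 11 ∷ 4 ∷ 9 ∷ 0 ∷ 7 ∷ 12 ∷ 5 ∷ 10 ∷ 1 ∷ 8 ∷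
  3 ∷ 6 ∷ 11 ∷ 0 ∷ 9 ∷ 4 ∷ 7 ∷ 12 ∷ 1 ∷ 10 ∷ 5 ∷ 8 ∷ 3 ∷ 0 ∷ 11 ∷ 6 ∷ 9 ∷ 4 ∷ 1 ∷ 12 ∷ 7 ∷ 10 ∷
  5 ∷ 0 ∷ 3 ∷ 8 ∷ 11 ∷ 6 ∷ 1 ∷ 4 ∷ 9 ∷ 12 ∷ 7 ∷ 2 ∷ 5 ∷ 0 ∷ 11 ∷ 8 ∷ 3 ∷ 6 ∷ 1 ∷ 12 ∷ 9 ∷ 4 ∷
  7 ∷ 2 ∷ 11 ∷ 0 ∷ 5 ∷ 8 ∷ 3 ∷ 12 ∷ 1 ∷ 6 ∷ 9 ∷ 4 ∷ 11 ∷ 2 ∷ 7 ∷ []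
prefix (suc (suc (suc (suc (suc zero))))) = 9 ∷ 0 ∷ 7 ∷ 12 ∷ 5 ∷ 10 ∷ 1 ∷ 8 ∷ 3 ∷ 6 ∷ 11 ∷ 0 ∷
  9 ∷ 4 ∷ 7 ∷ 12 ∷ 1 ∷ 10 ∷ 5 ∷ 8 ∷ 3 ∷ 0 ∷ 11 ∷ 6 ∷ 9 ∷ 4 ∷ 1 ∷ 12 ∷ 7 ∷ 10 ∷ 5 ∷ 0 ∷ 3 ∷ 8 ∷
  11 ∷ 6 ∷ 1 ∷ 4 ∷ 9 ∷ 12 ∷ 7 ∷ 2 ∷ 5 ∷ 0 ∷ 11 ∷ 8 ∷ 3 ∷ 6 ∷ 1 ∷ 12 ∷ 9 ∷ 4 ∷ 7 ∷ 2 ∷ 11 ∷ 0 ∷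
  5 ∷ 8 ∷ 3 ∷ 12 ∷ 1 ∷ 6 ∷ 9 ∷ 4 ∷ 11 ∷ 2 ∷ 7 ∷ 0 ∷ 5 ∷ 12 ∷ 3 ∷ 8 ∷ 1 ∷ 6 ∷ 11 ∷ 4 ∷ 9 ∷ 0 ∷
  7 ∷ 12 ∷ 5 ∷ 10 ∷ 1 ∷ 8 ∷ 3 ∷ 6 ∷ 11 ∷ 0 ∷ 9 ∷ 4 ∷ 7 ∷ 12 ∷ 1 ∷ 10 ∷ 5 ∷ 8 ∷ 3 ∷ 0 ∷ 11 ∷ 6 ∷
  9 ∷ 4 ∷ 1 ∷ 12 ∷ 7 ∷ 10 ∷ 5 ∷ 0 ∷ 3 ∷ 8 ∷ 11 ∷ 6 ∷ 1 ∷ 4 ∷ 9 ∷ 12 ∷ 7 ∷ 2 ∷ 5 ∷ 0 ∷ 11 ∷ 8 ∷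
  3 ∷ 6 ∷ 1 ∷ 12 ∷ 9 ∷ 4 ∷ 7 ∷ 2 ∷ 11 ∷ 0 ∷ 5 ∷ 8 ∷ 3 ∷ 12 ∷ 1 ∷ 6 ∷ 9 ∷ 4 ∷ 11 ∷ 2 ∷ 7 ∷ []

blocks : Fin 6 → ℕ
blocks zero = 1
blocks (suc zero) = 11
blocks (suc (suc zero)) = 8
blocks (suc (suc (suc zero))) = 6
blocks (suc (suc (suc (suc zero)))) = 2
blocks (suc (suc (suc (suc (suc zero))))) = 0

prefix-admissible : ∀ c → Admissible (prefix c)
prefix-admissible = from-yes (Fin.all? (admissible? ∘ prefix))

prefix-length : ∀ c a → 142 + 2 * toℕ c + a * 12 ≡ 9 + length (prefix c) + (blocks c + a) * 12
prefix-length c a = begin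
  142 + 2 * toℕ c + a * 12           ≡⟨ cong (_+ a * 12) (base c) ⟩
  L + blocks c * 12 + a * 12         ≡⟨ +-assoc L (blocks c * 12) (a * 12) ⟩
  L + (blocks c * 12 + a * 12)       ≡⟨ cong (L +_) (*-distribʳ-+ 12 (blocks c) a) ⟨
  L + (blocks c + a) * 12            ∎
  where
  L : ℕ
  L = 9 + length (prefix c)
  base : ∀ c → 142 + 2 * toℕ c ≡ 9 + length (prefix c) + blocks c * 12
  base = from-yes (Fin.all? λ c → 142 + 2 * toℕ c ≟ 9 + length (prefix c) + blocks c * 12)

even-decomposition : ∀ n → 2 ∣ n → 142 ≤ n → ∃₂ λ (c : Fin 6) a → n ≡ 142 + 2 * toℕ c + a * 12
even-decomposition n (divides h refl) 142≤n with (h ∸ 71) divMod 6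
... | result a c h∸71≡ = c , a , (begin
  h * 2                       ≡⟨ cong (_* 2) (m+[n∸m]≡n 71≤h) ⟨
  (71 + (h ∸ 71)) * 2         ≡⟨ cong (λ j → (71 + j) * 2) h∸71≡ ⟩
  (71 + (toℕ c + a * 6)) * 2  ≡⟨ normalise (toℕ c) a ⟩
  142 + 2 * toℕ c + a * 12    ∎)
  where
  71≤h : 71 ≤ h
  71≤h = *-cancelʳ-≤ 71 h 2 142≤n
  normalise : ∀ c a → (71 + (c + a * 6)) * 2 ≡ 142 + 2 * c + a * 12
  normalise = solve 2 (λ c a → (con 71 :+ (c :+ a :* con 6)) :* con 2 := con 142 :+ con 2 :* c :+ a :* con 12)
                refl

mainTheorem5 : (n : ℕ) → 2 ∣ n → 142 ≤ n → λ321≤ (CirculantAdj n (S13 n)) 12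
mainTheorem5 n 2∣n 142≤n with even-decomposition n 2∣n 142≤n
... | c , a , n≡ = subst (λ m → λ321≤ (CirculantAdj m (S13 m)) 12) (sym (trans n≡ (prefix-length c a)))
  (circulant-λ321≤12 (prefix c) (prefix-admissible c) (blocks c + a))
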